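{- For every $r\ge3$ and every mismatched pair $\{P,Q\}$ of $r$-patterns, there exists $1\le j\le r$ such that $\{P^{ -j},Q^{ -j}\}$ is a mismatched pair of $(r-1)$-patterns.
   Context: An $r$-pattern is an ordered $r$-matching of size 2 (two disjoint $r$-sets on a linearly ordered set of $2r$ vertices), up to order-isomorphism; it is written as a word of length $2r$ in letters $A,B$, each occurring $r$ times, beginning with $A$ (words differing by exchanging $A$ and $B$ represent the same pattern). For an $r$-pattern $P$ and $1\le j\le r$, $P^{ -j}$ is the $(r-1)$-pattern obtained by deleting from the word the $j$-th occurrence of $A$ and the $j$-th occurrence of $B$ (i.e. removing the $j$-th vertex from each edge). An $r$-pattern $P$ is collectable if it can be split into consecutive blocks $P=S_1\cdots S_s$, each of the form $A^tB^t$ or $B^tA^t$ for some $t\ge1$ (depending on the block); the splitting is unique and $\lambda_P=(|S_1|/2,\dots,|S_s|/2)$ is its composition. Two distinct collectable patterns are harmonious if they have the same composition. A pair $\{P,Q\}$ of patterns is a mismatch if one is collectable and the other is not, or both are collectable but have different compositions. -}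

module Defs where

open import Data.Nat using (ℕ; zero; suc; _*_; _≤_)
open import Data.List using (List; []; _∷_; _++_; length; replicate; map)
open import Data.Product using (Σ; _×_; ∃; ∃-syntax; proj₁)
open import Data.Sum using (_⊎_)
open import Relation.Nullary using (¬_)
open import Relation.Binary.PropositionalEquality using (_≡_)

data Letter : Set where
  A B : Letter

swap : Letter → Letter
swap A = B
swap B = A

count : Letter → List Letter → ℕ
count x [] = 0
count A (A ∷ w) = suc (count A w)
count A (B ∷ w) = count A w
count B (B ∷ w) = suc (count B w)
count B (A ∷ w) = count B w

StartsWithA : List Letter → Set
StartsWithA [] = Data.Unit.⊤ where import Data.Unit
StartsWithA (x ∷ _) = x ≡ A

-- An r-pattern: a word of length 2r in A,B with r A's and r B's, beginning with A
-- (the normal form of the pattern modulo exchanging A and B).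
record Pattern (r : ℕ) : Set where
  constructor mkPattern
  field
    word   : List Letter
    len    : length word ≡ 2 * r
    countA : count A word ≡ r
    countB : count B word ≡ r
    startA : StartsWithA word
open Pattern public

normalise : List Letter → List Letter
normalise [] = []
normalise (A ∷ w) = A ∷ w
normalise (B ∷ w) = map swap (B ∷ w)

-- delete the j-th occurrence (1-indexed) of letter x; no-op if j = 0 or there is none
delOcc : Letter → ℕ → List Letter → List Letter
delOcc x j [] = []
delOcc A j (B ∷ w) = B ∷ delOcc A j w
delOcc B j (A ∷ w) = A ∷ delOcc B j w
delOcc A zero (A ∷ w) = A ∷ w
delOcc A (suc zero) (A ∷ w) = w
delOcc A (suc (suc j)) (A ∷ w) = A ∷ delOcc A (suc j) w
delOcc B zero (B ∷ w) = B ∷ w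
delOcc B (suc zero) (B ∷ w) = w
delOcc B (suc (suc j)) (B ∷ w) = B ∷ delOcc B (suc j) w

-- P^{-j}: delete the j-th A and the j-th B, then normalise to begin with A.
minusWord : ℕ → List Letter → List Letter
minusWord j w = normalise (delOcc B j (delOcc A j w))

block : Letter → ℕ → List Letter
block x t = replicate t x ++ replicate t (swap x)

HasComposition : List Letter → List ℕ → Set
HasComposition [] [] = Data.Unit.⊤ where import Data.Unit
HasComposition [] (_ ∷ _) = Data.Empty.⊥ where import Data.Empty
HasComposition (_ ∷ _) [] = Data.Empty.⊥ where import Data.Empty
HasComposition w (t ∷ λs) =
  1 ≤ t × Σ Letter (λ x → Σ (List Letter) (λ rest →
    (w ≡ block x t ++ rest) × HasComposition rest λs))

Collectable : List Letter → Set
Collectable w = ∃[ λs ] HasComposition w λs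

MismatchW : List Letter → List Letter → Set
MismatchW p q =
  (Collectable p × ¬ Collectable q)
  ⊎ (¬ Collectable p × Collectable q)
  ⊎ (Collectable p × Collectable q ×
       ((λp λq : List ℕ) → HasComposition p λp → HasComposition q λq → ¬ (λp ≡ λq)))

Mismatch : ∀ {r} → Pattern r → Pattern r → Set
Mismatch P Q = MismatchW (word P) (word Q)

MismatchMinus : ∀ {r} → ℕ → Pattern r → Pattern r → Set
MismatchMinus j P Q = MismatchW (minusWord j (word P)) (minusWord j (word Q))

module Submission where

-- Number the occurrences of each letter, so that the j-th vertex pair of a pattern is the j-th A
-- together with the j-th B. A balanced word is collectable exactly when it contains no
-- occurrences x_p x_q y_p x_s y_q in this order (y the other letter): peeling off the leading
-- block X^t Y^t either succeeds or exhibits such a configuration. The configuration survives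
-- the deletion of every pair j outside {p, q, s}, while deleting the pair j from a collectable
-- word just shrinks the part of its composition containing j. Hence for r ≥ 4 a collectable and
-- a non-collectable pattern stay mismatched after deleting some j ≤ 4 avoiding p, q, s; two
-- different compositions of the same r ≥ 3 are told apart by deleting some j ≤ 3; and for r = 3
-- the only non-collectable pattern is AABABB, whose deletions are computed directly.

open import Defs
open import Data.Empty using (⊥; ⊥-elim)
open import Data.List using (List; []; _∷_; _++_; length; replicate; map)
open import Data.List.Properties using (++-assoc; ++-cancelˡ; ++-identityʳ; map-++; map-replicate; length-map; length-++-≤ʳ; ∷-injective; ∷-injectiveˡ; ∷-injectiveʳ; ≡-dec)
open import Data.List.Relation.Binary.Sublist.Propositional using (_⊆_; []; _∷_; _∷ʳ_; minimum)
open import Data.List.Relation.Binary.Sublist.Propositional.Properties using (map⁺; All-resp-⊆)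
open import Data.List.Relation.Unary.All using (All; []; _∷_)
import Data.List.Relation.Unary.All as All
open import Data.List.Relation.Unary.All.Properties using (++⁺)
open import Data.Nat using (ℕ; zero; suc; _+_; _∸_; _≤_; _<_; z≤n; s≤s; pred)
open import Data.Nat.ListAction using (sum)
open import Data.Nat.Properties using (_≟_; _≤?_; +-suc; +-assoc; +-identityʳ; +-cancelˡ-≡; +-cancelˡ-≤; ≤-refl; ≤-reflexive; ≤-trans; ≤-pred; ≤⇒≯; ≰⇒>; >⇒≢; m≤n+m; n≤1+n; m+n∸m≡n; m+1+n≢m; 1+n≢n; m≤n⇒∃[o]m+o≡n)
open import Data.Product using (Σ; _×_; _,_; proj₁; proj₂; ∃-syntax)
open import Data.Sum using (_⊎_; inj₁; inj₂)
open import Data.Unit using (⊤; tt)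
open import Relation.Nullary using (¬_; Dec; yes; no)
open import Relation.Binary.PropositionalEquality using (_≡_; _≢_; refl; sym; trans; cong; cong₂; subst; module ≡-Reasoning)

open ≡-Reasoning

_≟ᴸ_ : (x y : Letter) → Dec (x ≡ y)
A ≟ᴸ A = yes refl
A ≟ᴸ B = no λ ()
B ≟ᴸ A = no λ ()
B ≟ᴸ B = yes refl

swap-involutive : ∀ x → swap (swap x) ≡ x
swap-involutive A = refl
swap-involutive B = refl

swap-≢ : ∀ x → swap x ≢ x
swap-≢ A ()
swap-≢ B ()

map-swap-involutive : ∀ w → map swap (map swap w) ≡ w
map-swap-involutive [] = refl
map-swap-involutive (x ∷ w) = cong₂ _∷_ (swap-involutive x) (map-swap-involutive w)

map-swap-block : ∀ x t → map swap (block x t) ≡ block (swap x) t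
map-swap-block x t = trans (map-++ swap (replicate t x) (replicate t (swap x)))
  (cong₂ _++_ (map-replicate swap t x) (map-replicate swap t (swap x)))

replicate-+ : ∀ {X : Set} m n (x : X) w → replicate (m + n) x ++ w ≡ replicate m x ++ replicate n x ++ w
replicate-+ zero n x w = refl
replicate-+ (suc m) n x w = cong (x ∷_) (replicate-+ m n x w)

count-replicate : ∀ t x w → count x (replicate t x ++ w) ≡ t + count x w
count-replicate zero x w = refl
count-replicate (suc t) A w = cong suc (count-replicate t A w)
count-replicate (suc t) B w = cong suc (count-replicate t B w)

count-replicate-swap : ∀ t x w → count x (replicate t (swap x) ++ w) ≡ count x w
count-replicate-swap zero x w = refl
count-replicate-swap (suc t) A w = count-replicate-swap t A w
count-replicate-swap (suc t) B w = count-replicate-swap t B w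

count-block : ∀ z t x w → count x (block z t ++ w) ≡ t + count x w
count-block z t x w rewrite ++-assoc (replicate t z) (replicate t (swap z)) w = by-letters z x
  where
  by-letters : ∀ z x → count x (replicate t z ++ replicate t (swap z) ++ w) ≡ t + count x w
  by-letters A A = trans (count-replicate t A _) (cong (t +_) (count-replicate-swap t A w))
  by-letters A B = trans (count-replicate-swap t B _) (count-replicate t B w)
  by-letters B A = trans (count-replicate-swap t A _) (count-replicate t A w)
  by-letters B B = trans (count-replicate t B _) (cong (t +_) (count-replicate-swap t B w))

count-map-swap : ∀ x w → count x (map swap w) ≡ count (swap x) w
count-map-swap x [] = refl
count-map-swap A (A ∷ w) = count-map-swap A w
count-map-swap A (B ∷ w) = cong suc (count-map-swap A w)
count-map-swap B (A ∷ w) = cong suc (count-map-swap B w)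
count-map-swap B (B ∷ w) = count-map-swap B w

HasComposition-map-swap : ∀ w ls → HasComposition w ls → HasComposition (map swap w) ls
HasComposition-map-swap [] [] h = tt
HasComposition-map-swap (c ∷ w) (t ∷ ls) (1≤t , z , rest , eq , h) =
  1≤t , swap z , map swap rest ,
  trans (cong (map swap) eq) (trans (map-++ swap (block z t) rest) (cong (_++ map swap rest) (map-swap-block z t))) ,
  HasComposition-map-swap rest ls h

composition-sum : ∀ w ls → HasComposition w ls → sum ls ≡ count A w
composition-sum [] [] h = refl
composition-sum (c ∷ w) (t ∷ ls) (_ , z , rest , eq , h) =
  trans (cong (t +_) (composition-sum rest ls h)) (sym (trans (cong (count A) eq) (count-block z t A rest)))

composition-positive : ∀ w ls → HasComposition w ls → All (1 ≤_) ls
composition-positive [] [] h = []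
composition-positive (c ∷ w) (t ∷ ls) (1≤t , _ , rest , _ , h) = 1≤t ∷ composition-positive rest ls h

replicate-run-injective : ∀ a b {x y : Letter} {u u'} → y ≢ x →
  replicate a x ++ y ∷ u ≡ replicate b x ++ y ∷ u' → a ≡ b × u ≡ u'
replicate-run-injective zero zero y≢x e = refl , ∷-injectiveʳ e
replicate-run-injective zero (suc b) y≢x e = ⊥-elim (y≢x (∷-injectiveˡ e))
replicate-run-injective (suc a) zero y≢x e = ⊥-elim (y≢x (sym (∷-injectiveˡ e)))
replicate-run-injective (suc a) (suc b) y≢x e with replicate-run-injective a b y≢x (∷-injectiveʳ e)
... | refl , u≡u' = refl , u≡u'

block-injective : ∀ {x x' t t'} rest rest' → 1 ≤ t → 1 ≤ t' →
  block x t ++ rest ≡ block x' t' ++ rest' → x ≡ x' × t ≡ t' × rest ≡ rest'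
block-injective {x} {_} {suc a} {suc b} rest rest' _ _ e with ∷-injective e
... | refl , e' with replicate-run-injective a b (swap-≢ x)
                       (trans (sym (++-assoc (replicate a x) _ rest)) (trans e' (++-assoc (replicate b x) _ rest')))
... | refl , e'' = refl , refl , ++-cancelˡ (replicate a (swap x)) rest rest' e''

composition-unique : ∀ w l l' → HasComposition w l → HasComposition w l' → l ≡ l'
composition-unique [] [] [] _ _ = refl
composition-unique (c ∷ w) (t ∷ l) (t' ∷ l') (1≤t , z , rest , e , h) (1≤t' , z' , rest' , e' , h')
  with block-injective rest rest' 1≤t 1≤t' (trans (sym e) e')
... | refl , refl , refl = cong (t ∷_) (composition-unique rest l l' h h')

Occurrence : Set
Occurrence = Letter × ℕ

-- (x , i) is the i-th occurrence of x; the A's are numbered from a + 1 and the B's from b + 1.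
occurrences : ℕ → ℕ → List Letter → List Occurrence
occurrences a b [] = []
occurrences a b (A ∷ w) = (A , suc a) ∷ occurrences (suc a) b w
occurrences a b (B ∷ w) = (B , suc b) ∷ occurrences a (suc b) w

forbidden : Letter → ℕ → ℕ → ℕ → List Occurrence
forbidden x p q s = (x , p) ∷ (x , q) ∷ (swap x , p) ∷ (x , s) ∷ (swap x , q) ∷ []

Obstructed : List Occurrence → Set
Obstructed L = ∃[ x ] ∃[ p ] ∃[ q ] ∃[ s ] forbidden x p q s ⊆ L

swapᴼ : Occurrence → Occurrence
swapᴼ (x , i) = swap x , i

map-swapᴼ-involutive : ∀ L → map swapᴼ (map swapᴼ L) ≡ L
map-swapᴼ-involutive [] = refl
map-swapᴼ-involutive ((x , i) ∷ L) = cong₂ _∷_ (cong (_, i) (swap-involutive x)) (map-swapᴼ-involutive L)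

occurrences-map-swap : ∀ a b w → occurrences a b (map swap w) ≡ map swapᴼ (occurrences b a w)
occurrences-map-swap a b [] = refl
occurrences-map-swap a b (A ∷ w) = cong (_ ∷_) (occurrences-map-swap a (suc b) w)
occurrences-map-swap a b (B ∷ w) = cong (_ ∷_) (occurrences-map-swap (suc a) b w)

occurrences-above : ∀ c a b w → c ≤ a → c ≤ b → All (λ o → c < proj₂ o) (occurrences a b w)
occurrences-above c a b [] _ _ = []
occurrences-above c a b (A ∷ w) c≤a c≤b = s≤s c≤a ∷ occurrences-above c (suc a) b w (≤-trans c≤a (n≤1+n a)) c≤b
occurrences-above c a b (B ∷ w) c≤a c≤b = s≤s c≤b ∷ occurrences-above c a (suc b) w c≤a (≤-trans c≤b (n≤1+n b))

skip-runA : ∀ n a b w {xs} → xs ⊆ occurrences (n + a) b w → xs ⊆ occurrences a b (replicate n A ++ w)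
skip-runA zero a b w sub = sub
skip-runA (suc n) a b w {xs} sub =
  _ ∷ʳ skip-runA n (suc a) b w (subst (λ k → xs ⊆ occurrences k b w) (sym (+-suc n a)) sub)

skip-runB : ∀ n a b w {xs} → xs ⊆ occurrences a (n + b) w → xs ⊆ occurrences a b (replicate n B ++ w)
skip-runB zero a b w sub = sub
skip-runB (suc n) a b w {xs} sub =
  _ ∷ʳ skip-runB n a (suc b) w (subst (λ k → xs ⊆ occurrences a k w) (sym (+-suc n b)) sub)

skip-block : ∀ z t a rest {xs} → xs ⊆ occurrences (t + a) (t + a) rest → xs ⊆ occurrences a a (block z t ++ rest)
skip-block A t a rest {xs} sub = subst (λ v → xs ⊆ occurrences a a v) (sym (++-assoc (replicate t A) (replicate t B) rest))
  (skip-runA t a a _ (skip-runB t (t + a) a rest sub))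
skip-block B t a rest {xs} sub = subst (λ v → xs ⊆ occurrences a a v) (sym (++-assoc (replicate t B) (replicate t A) rest))
  (skip-runB t a a _ (skip-runA t a (t + a) rest sub))

Early : Letter → ℕ → Occurrence → Set
Early z m o = proj₁ o ≡ z × proj₂ o ≤ m

SplitEarly : Letter → ℕ → List Occurrence → List Occurrence → Set
SplitEarly z m xs L = ∃[ ys ] ∃[ zs ] xs ≡ ys ++ zs × All (Early z m) ys × zs ⊆ L

split-runA : ∀ n a b w xs → xs ⊆ occurrences a b (replicate n A ++ w) → SplitEarly A (n + a) xs (occurrences (n + a) b w)
split-runA zero a b w xs sub = [] , xs , refl , [] , sub
split-runA (suc n) a b w xs (_ ∷ʳ sub) with split-runA n (suc a) b w xs sub
... | ys , zs , e , early , sub' rewrite +-suc n a = ys , zs , e , early , sub'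
split-runA (suc n) a b w (_ ∷ xs) (refl ∷ sub) with split-runA n (suc a) b w xs sub
... | ys , zs , e , early , sub' rewrite +-suc n a = _ ∷ ys , zs , cong (_ ∷_) e , (refl , s≤s (m≤n+m a n)) ∷ early , sub'

split-runB : ∀ n a b w xs → xs ⊆ occurrences a b (replicate n B ++ w) → SplitEarly B (n + b) xs (occurrences a (n + b) w)
split-runB zero a b w xs sub = [] , xs , refl , [] , sub
split-runB (suc n) a b w xs (_ ∷ʳ sub) with split-runB n a (suc b) w xs sub
... | ys , zs , e , early , sub' rewrite +-suc n b = ys , zs , e , early , sub'
split-runB (suc n) a b w (_ ∷ xs) (refl ∷ sub) with split-runB n a (suc b) w xs sub
... | ys , zs , e , early , sub' rewrite +-suc n b = _ ∷ ys , zs , cong (_ ∷_) e , (refl , s≤s (m≤n+m b n)) ∷ early , sub'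

split-block : ∀ z t a rest xs → xs ⊆ occurrences a a (block z t ++ rest) →
  ∃[ ys₁ ] ∃[ ys₂ ] ∃[ zs ] xs ≡ (ys₁ ++ ys₂) ++ zs × All (Early z (t + a)) ys₁ × All (Early (swap z) (t + a)) ys₂ ×
    zs ⊆ occurrences (t + a) (t + a) rest
split-block A t a rest xs sub
  with split-runA t a a (replicate t B ++ rest) xs (subst (λ v → xs ⊆ occurrences a a v) (++-assoc (replicate t A) _ rest) sub)
... | ys₁ , zs₁ , e₁ , early₁ , sub₁ with split-runB t (t + a) a rest zs₁ sub₁
... | ys₂ , zs , e₂ , early₂ , sub₂ =
  ys₁ , ys₂ , zs , trans e₁ (trans (cong (ys₁ ++_) e₂) (sym (++-assoc ys₁ ys₂ zs))) , early₁ , early₂ , sub₂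
split-block B t a rest xs sub
  with split-runB t a a (replicate t A ++ rest) xs (subst (λ v → xs ⊆ occurrences a a v) (++-assoc (replicate t B) _ rest) sub)
... | ys₁ , zs₁ , e₁ , early₁ , sub₁ with split-runA t a (t + a) rest zs₁ sub₁
... | ys₂ , zs , e₂ , early₂ , sub₂ =
  ys₁ , ys₂ , zs , trans e₁ (trans (cong (ys₁ ++_) e₂) (sym (++-assoc ys₁ ys₂ zs))) , early₁ , early₂ , sub₂

-- Forbidden configurations obstruct collectability

forbidden-straddle : ∀ x p q s m ys zs → forbidden x p q s ≡ ys ++ zs →
  All (λ o → proj₂ o ≤ m) ys → All (λ o → m < proj₂ o) zs → ys ≡ [] ⊎ zs ≡ []
forbidden-straddle x p q s m [] zs e _ _ = inj₁ refl
forbidden-straddle x p q s m (_ ∷ []) _ refl (h ∷ []) (_ ∷ g ∷ _) = ⊥-elim (≤⇒≯ h g)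
forbidden-straddle x p q s m (_ ∷ _ ∷ []) _ refl (h ∷ _) (g ∷ _) = ⊥-elim (≤⇒≯ h g)
forbidden-straddle x p q s m (_ ∷ _ ∷ _ ∷ []) _ refl (_ ∷ h ∷ _) (_ ∷ g ∷ _) = ⊥-elim (≤⇒≯ h g)
forbidden-straddle x p q s m (_ ∷ _ ∷ _ ∷ _ ∷ []) _ refl (_ ∷ h ∷ _) (g ∷ _) = ⊥-elim (≤⇒≯ h g)
forbidden-straddle x p q s m (_ ∷ _ ∷ _ ∷ _ ∷ _ ∷ []) _ refl _ _ = inj₂ refl
forbidden-straddle x p q s m (_ ∷ _ ∷ _ ∷ _ ∷ _ ∷ _ ∷ _) _ () _ _

forbidden-not-two-runs : ∀ x p q s z ys zs → forbidden x p q s ≡ ys ++ zs →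
  All (λ o → proj₁ o ≡ z) ys → All (λ o → proj₁ o ≡ swap z) zs → ⊥
forbidden-not-two-runs x p q s z [] _ refl _ (g₁ ∷ _ ∷ g₃ ∷ _) = swap-≢ x (trans g₃ (sym g₁))
forbidden-not-two-runs x p q s z (_ ∷ []) _ refl (h₁ ∷ _) (g₂ ∷ _) = swap-≢ z (trans (sym g₂) h₁)
forbidden-not-two-runs x p q s z (_ ∷ _ ∷ []) _ refl (h₁ ∷ _) (_ ∷ g₄ ∷ _) = swap-≢ z (trans (sym g₄) h₁)
forbidden-not-two-runs x p q s z (_ ∷ _ ∷ _ ∷ []) _ refl (h₁ ∷ _ ∷ h₃ ∷ _) _ = swap-≢ x (trans h₃ (sym h₁))
forbidden-not-two-runs x p q s z (_ ∷ _ ∷ _ ∷ _ ∷ []) _ refl (h₁ ∷ _ ∷ h₃ ∷ _) _ = swap-≢ x (trans h₃ (sym h₁))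
forbidden-not-two-runs x p q s z (_ ∷ _ ∷ _ ∷ _ ∷ _ ∷ []) _ refl (h₁ ∷ _ ∷ h₃ ∷ _) _ = swap-≢ x (trans h₃ (sym h₁))
forbidden-not-two-runs x p q s z (_ ∷ _ ∷ _ ∷ _ ∷ _ ∷ _ ∷ _) _ () _ _

forbidden-beyond-block : ∀ {x p q s} z m ys₁ ys₂ zs → forbidden x p q s ≡ (ys₁ ++ ys₂) ++ zs →
  All (Early z m) ys₁ → All (Early (swap z) m) ys₂ → All (λ o → m < proj₂ o) zs → forbidden x p q s ≡ zs
forbidden-beyond-block {x} {p} {q} {s} z m ys₁ ys₂ zs e early₁ early₂ late
  with forbidden-straddle x p q s m (ys₁ ++ ys₂) zs e (++⁺ (All.map proj₂ early₁) (All.map proj₂ early₂)) late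
... | inj₁ ys≡[] = trans e (cong (_++ zs) ys≡[])
... | inj₂ refl = ⊥-elim (forbidden-not-two-runs x p q s z ys₁ ys₂
                           (trans e (++-identityʳ (ys₁ ++ ys₂))) (All.map proj₁ early₁) (All.map proj₁ early₂))

obstructed-¬HasComposition : ∀ ls a w → Obstructed (occurrences a a w) → ¬ HasComposition w ls
obstructed-¬HasComposition (t ∷ ls) a (c ∷ w) (x , p , q , s , sub) (_ , z , rest , eq , h)
  with split-block z t a rest _ (subst (λ v → forbidden x p q s ⊆ occurrences a a v) eq sub)
... | ys₁ , ys₂ , zs , e , early₁ , early₂ , sub' =
  obstructed-¬HasComposition ls (t + a) rest
    (x , p , q , s , subst (_⊆ occurrences (t + a) (t + a) rest)
      (sym (forbidden-beyond-block z (t + a) ys₁ ys₂ zs e early₁ early₂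
             (All-resp-⊆ sub' (occurrences-above (t + a) (t + a) (t + a) rest ≤-refl ≤-refl)))) sub') h

obstructed⇒¬collectable : ∀ w → Obstructed (occurrences 0 0 w) → ¬ Collectable w
obstructed⇒¬collectable w obstructed (ls , h) = obstructed-¬HasComposition ls 0 w obstructed h

-- Balanced words are collectable or obstructed

StartsWithout : Letter → List Letter → Set
StartsWithout x [] = ⊤
StartsWithout x (y ∷ _) = y ≢ x

leadingRun : ∀ x v → ∃[ t ] ∃[ u ] v ≡ replicate t x ++ u × StartsWithout x u
leadingRun x [] = 0 , [] , refl , tt
leadingRun x (y ∷ v) with y ≟ᴸ x
... | no y≢x = 0 , y ∷ v , refl , y≢x
... | yes refl with leadingRun x v
...   | t , u , refl , u≢x = suc t , u , refl , u≢x

firstB⊎noB : ∀ u → (∃[ e ] ∃[ u' ] u ≡ replicate e A ++ B ∷ u') ⊎ count B u ≡ 0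
firstB⊎noB u with leadingRun A u
... | e , [] , refl , _ = inj₂ (count-replicate-swap e B [])
... | e , A ∷ _ , refl , u≢A = ⊥-elim (u≢A refl)
... | e , B ∷ u' , refl , _ = inj₁ (e , u' , refl)

≤⊎> : ∀ m n → (∃[ e ] n ≡ m + e) ⊎ (∃[ d ] m ≡ n + suc d)
≤⊎> zero n = inj₁ (n , refl)
≤⊎> (suc m) zero = inj₂ (m , refl)
≤⊎> (suc m) (suc n) with ≤⊎> m n
... | inj₁ (e , refl) = inj₁ (e , refl)
... | inj₂ (d , refl) = inj₂ (d , refl)

runs-balance : ∀ t k u → count A (replicate t A ++ replicate k B ++ u) ≡ count B (replicate t A ++ replicate k B ++ u) →
  t + count A u ≡ k + count B u
runs-balance t k u bal = begin
  t + count A u                                   ≡⟨ cong (t +_) (sym (count-replicate-swap k A u)) ⟩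
  t + count A (replicate k B ++ u)                ≡⟨ sym (count-replicate t A _) ⟩
  count A (replicate t A ++ replicate k B ++ u)   ≡⟨ bal ⟩
  count B (replicate t A ++ replicate k B ++ u)   ≡⟨ count-replicate-swap t B _ ⟩
  count B (replicate k B ++ u)                    ≡⟨ count-replicate k B u ⟩
  k + count B u                                   ∎

runs-block : ∀ t e u → replicate t A ++ replicate (t + e) B ++ u ≡ block A t ++ replicate e B ++ u
runs-block t e u = begin
  replicate t A ++ replicate (t + e) B ++ u          ≡⟨ cong (replicate t A ++_) (replicate-+ t e B u) ⟩
  replicate t A ++ replicate t B ++ replicate e B ++ u ≡⟨ sym (++-assoc (replicate t A) (replicate t B) _) ⟩
  block A t ++ replicate e B ++ u                    ∎

balanced-after-block : ∀ t e u → t + count A u ≡ (t + e) + count B u →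
  count A (replicate e B ++ u) ≡ count B (replicate e B ++ u)
balanced-after-block t e u bal = begin
  count A (replicate e B ++ u) ≡⟨ count-replicate-swap e A u ⟩
  count A u                    ≡⟨ +-cancelˡ-≡ t _ _ (trans bal (+-assoc t e _)) ⟩
  e + count B u                ≡⟨ sym (count-replicate e B u) ⟩
  count B (replicate e B ++ u) ∎

length-after-block : ∀ x t rest {n} → length (block x (suc t) ++ rest) ≤ suc n → length rest ≤ n
length-after-block x t rest l = ≤-trans (length-++-≤ʳ rest {replicate t x ++ replicate (suc t) (swap x)}) (≤-pred l)

run-excess-≢ : ∀ k d c → suc (k + suc d) + c ≢ suc k + 0
run-excess-≢ k d c eq = m+1+n≢m (suc k) (begin
  suc k + suc (d + c) ≡⟨ cong suc (sym (+-assoc k (suc d) c)) ⟩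
  suc (k + suc d) + c ≡⟨ eq ⟩
  suc k + 0           ≡⟨ +-identityʳ (suc k) ⟩
  suc k               ∎)

-- A^{k+1+d+1} B^{k+1} A^{e+1} B … contains A_1 A_{k+2} B_1 A_{k+d+3} B_{k+2}.
runs-obstructed : ∀ a k d e u →
  Obstructed (occurrences a a (replicate (suc (k + suc d)) A ++ replicate (suc k) B ++ replicate (suc e) A ++ B ∷ u))
runs-obstructed a k d e u =
  A , suc a , _ , _ , refl ∷ subst (λ v → _ ⊆ occurrences (suc a) a v) (sym (replicate-+ k (suc d) A _))
    (skip-runA k (suc a) a _ (refl ∷ skip-runA d _ a _ (refl ∷ skip-runB k _ (suc a) _
      (refl ∷ skip-runA e _ _ _ (refl ∷ minimum _)))))

CollectableOrObstructed : ℕ → List Letter → Set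
CollectableOrObstructed a w = Collectable w ⊎ Obstructed (occurrences a a w)

collectable⊎obstructed : ∀ n a w → length w ≤ n → count A w ≡ count B w → CollectableOrObstructed a w

collectable⊎obstructedᴬ : ∀ n a w → length (A ∷ w) ≤ suc n → count A (A ∷ w) ≡ count B (A ∷ w) →
  CollectableOrObstructed a (A ∷ w)

-- If the B-run is at least as long as the A-run, a block is peeled off; otherwise balance
-- forces a later B, and runs-obstructed applies.
collectable⊎obstructed-runs : ∀ n a t k u → length (replicate (suc t) A ++ replicate k B ++ u) ≤ suc n →
  StartsWithout A (replicate k B ++ u) → StartsWithout B u → suc t + count A u ≡ k + count B u →
  CollectableOrObstructed a (replicate (suc t) A ++ replicate k B ++ u)

collectable⊎obstructed n a [] _ _ = inj₁ ([] , tt)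
collectable⊎obstructed (suc n) a (A ∷ w) l bal = collectable⊎obstructedᴬ n a w l bal
collectable⊎obstructed (suc n) a (B ∷ w) l bal
  with collectable⊎obstructedᴬ n a (map swap w) (subst (λ k → suc k ≤ suc n) (sym (length-map swap w)) l)
         (trans (cong suc (count-map-swap A w)) (trans (sym bal) (sym (count-map-swap B w))))
... | inj₁ (ls , h) =
  inj₁ (ls , subst (λ v → HasComposition v ls) (map-swap-involutive (B ∷ w)) (HasComposition-map-swap (A ∷ map swap w) ls h))
... | inj₂ (x , p , q , s , sub) =
  inj₂ (swap x , p , q , s , subst (forbidden (swap x) p q s ⊆_) (map-swapᴼ-involutive (occurrences a a (B ∷ w)))
    (map⁺ swapᴼ (subst (forbidden x p q s ⊆_) (occurrences-map-swap a a (B ∷ w)) sub)))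

collectable⊎obstructedᴬ n a w l bal with leadingRun A w
... | t , u , refl , u≢A with leadingRun B u
... | k , u' , refl , u'≢B = collectable⊎obstructed-runs n a t k u' l u≢A u'≢B (runs-balance (suc t) k u' bal)

collectable⊎obstructed-runs n a t zero [] _ _ _ ()
collectable⊎obstructed-runs n a t zero (A ∷ u) _ u≢A _ _ = ⊥-elim (u≢A refl)
collectable⊎obstructed-runs n a t zero (B ∷ u) _ _ u≢B _ = ⊥-elim (u≢B refl)
collectable⊎obstructed-runs n a t (suc k) u l _ u≢B bal with ≤⊎> t k
... | inj₁ (e , refl)
  with collectable⊎obstructed n (suc t + a) (replicate e B ++ u)
         (length-after-block A t _ (subst (λ v → length v ≤ suc n) (runs-block (suc t) e u) l))
         (balanced-after-block (suc t) e u bal)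
...   | inj₁ (ls , h) = inj₁ (suc t ∷ ls , s≤s z≤n , A , _ , runs-block (suc t) e u , h)
...   | inj₂ (x , p , q , s , sub) =
  inj₂ (x , p , q , s , subst (λ v → forbidden x p q s ⊆ occurrences a a v) (sym (runs-block (suc t) e u)) (skip-block A (suc t) a _ sub))
collectable⊎obstructed-runs n a t (suc k) u l _ u≢B bal | inj₂ (d , refl) with firstB⊎noB u
... | inj₂ noB = ⊥-elim (run-excess-≢ k d (count A u) (trans bal (cong (suc k +_) noB)))
... | inj₁ (zero , u' , refl) = ⊥-elim (u≢B refl)
... | inj₁ (suc e , u' , refl) = inj₂ (runs-obstructed a k d e u')

-- Deletion preserves obstructions

dropVertex : ℕ → List Letter → List Letter
dropVertex j w = delOcc B j (delOcc A j w)

unshift : ℕ → ℕ → ℕ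
unshift c zero = zero
unshift zero (suc i) = i
unshift (suc c) (suc i) = suc (unshift c i)

unshift-> : ∀ {c i} → c < i → unshift c i ≡ pred i
unshift-> {zero} {suc i} _ = refl
unshift-> {suc c} {suc (suc i)} (s≤s c<i) = cong suc (unshift-> c<i)

unshift-≤ : ∀ {c i} → i ≤ c → unshift c i ≡ i
unshift-≤ {c} {zero} _ = refl
unshift-≤ {suc c} {suc i} (s≤s i≤c) = cong suc (unshift-≤ i≤c)

unshiftᴼ : Letter → ℕ → Occurrence → Occurrence
unshiftᴼ A c (A , i) = A , unshift c i
unshiftᴼ A c (B , i) = B , i
unshiftᴼ B c (A , i) = A , i
unshiftᴼ B c (B , i) = B , unshift c i

occurrences-unshiftA : ∀ c a b w → c ≤ suc a → map (unshiftᴼ A c) (occurrences (suc a) b w) ≡ occurrences a b w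
occurrences-unshiftA c a b [] _ = refl
occurrences-unshiftA c a b (A ∷ w) c≤ =
  cong₂ _∷_ (cong (A ,_) (unshift-> (s≤s c≤))) (occurrences-unshiftA c (suc a) b w (≤-trans c≤ (n≤1+n _)))
occurrences-unshiftA c a b (B ∷ w) c≤ = cong (_ ∷_) (occurrences-unshiftA c a (suc b) w c≤)

occurrences-unshiftB : ∀ c a b w → c ≤ suc b → map (unshiftᴼ B c) (occurrences a (suc b) w) ≡ occurrences a b w
occurrences-unshiftB c a b [] _ = refl
occurrences-unshiftB c a b (B ∷ w) c≤ =
  cong₂ _∷_ (cong (B ,_) (unshift-> (s≤s c≤))) (occurrences-unshiftB c a (suc b) w (≤-trans c≤ (n≤1+n _)))
occurrences-unshiftB c a b (A ∷ w) c≤ = cong (_ ∷_) (occurrences-unshiftB c (suc a) b w c≤)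

delOccA-⊆ : ∀ j a b c w {xs} → c ≡ suc (j + a) → xs ⊆ occurrences a b w → All (_≢ (A , c)) xs →
  map (unshiftᴼ A c) xs ⊆ occurrences a b (delOcc A (suc j) w)
delOccA-⊆ j a b c [] _ [] _ = []
delOccA-⊆ j a b c (B ∷ w) c≡ (_ ∷ʳ sub) avoid = _ ∷ʳ delOccA-⊆ j a (suc b) c w c≡ sub avoid
delOccA-⊆ j a b c (B ∷ w) c≡ (refl ∷ sub) (_ ∷ avoid) = refl ∷ delOccA-⊆ j a (suc b) c w c≡ sub avoid
delOccA-⊆ zero a b c (A ∷ w) {xs} c≡ (_ ∷ʳ sub) _ =
  subst (map (unshiftᴼ A c) xs ⊆_) (occurrences-unshiftA c a b w (≤-reflexive c≡)) (map⁺ (unshiftᴼ A c) sub)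
delOccA-⊆ zero a b c (A ∷ w) c≡ (refl ∷ _) (≢c ∷ _) = ⊥-elim (≢c (cong (A ,_) (sym c≡)))
delOccA-⊆ (suc j) a b c (A ∷ w) c≡ (_ ∷ʳ sub) avoid =
  _ ∷ʳ delOccA-⊆ j (suc a) b c w (trans c≡ (cong suc (sym (+-suc j a)))) sub avoid
delOccA-⊆ (suc j) a b c (A ∷ w) c≡ (refl ∷ sub) (_ ∷ avoid) =
  cong (A ,_) (unshift-≤ (≤-trans (s≤s (m≤n+m a (suc j))) (≤-reflexive (sym c≡)))) ∷
  delOccA-⊆ j (suc a) b c w (trans c≡ (cong suc (sym (+-suc j a)))) sub avoid

delOccB-⊆ : ∀ j a b c w {xs} → c ≡ suc (j + b) → xs ⊆ occurrences a b w → All (_≢ (B , c)) xs →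
  map (unshiftᴼ B c) xs ⊆ occurrences a b (delOcc B (suc j) w)
delOccB-⊆ j a b c [] _ [] _ = []
delOccB-⊆ j a b c (A ∷ w) c≡ (_ ∷ʳ sub) avoid = _ ∷ʳ delOccB-⊆ j (suc a) b c w c≡ sub avoid
delOccB-⊆ j a b c (A ∷ w) c≡ (refl ∷ sub) (_ ∷ avoid) = refl ∷ delOccB-⊆ j (suc a) b c w c≡ sub avoid
delOccB-⊆ zero a b c (B ∷ w) {xs} c≡ (_ ∷ʳ sub) _ =
  subst (map (unshiftᴼ B c) xs ⊆_) (occurrences-unshiftB c a b w (≤-reflexive c≡)) (map⁺ (unshiftᴼ B c) sub)
delOccB-⊆ zero a b c (B ∷ w) c≡ (refl ∷ _) (≢c ∷ _) = ⊥-elim (≢c (cong (B ,_) (sym c≡)))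
delOccB-⊆ (suc j) a b c (B ∷ w) c≡ (_ ∷ʳ sub) avoid =
  _ ∷ʳ delOccB-⊆ j a (suc b) c w (trans c≡ (cong suc (sym (+-suc j b)))) sub avoid
delOccB-⊆ (suc j) a b c (B ∷ w) c≡ (refl ∷ sub) (_ ∷ avoid) =
  cong (B ,_) (unshift-≤ (≤-trans (s≤s (m≤n+m b (suc j))) (≤-reflexive (sym c≡)))) ∷
  delOccB-⊆ j a (suc b) c w (trans c≡ (cong suc (sym (+-suc j b)))) sub avoid

unshiftA-avoidsB : ∀ c xs → All (_≢ (B , c)) xs → All (_≢ (B , c)) (map (unshiftᴼ A c) xs)
unshiftA-avoidsB c [] [] = []
unshiftA-avoidsB c ((A , i) ∷ xs) (_ ∷ avoid) = (λ ()) ∷ unshiftA-avoidsB c xs avoid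
unshiftA-avoidsB c ((B , i) ∷ xs) (≢ ∷ avoid) = ≢ ∷ unshiftA-avoidsB c xs avoid

forbidden-avoids : ∀ j x p q s z → j ≢ p → j ≢ q → j ≢ s → All (_≢ (z , j)) (forbidden x p q s)
forbidden-avoids j x p q s z j≢p j≢q j≢s =
  avoid j≢p ∷ avoid j≢q ∷ avoid j≢p ∷ avoid j≢s ∷ avoid j≢q ∷ []
  where
  avoid : ∀ {i} {y : Letter} → j ≢ i → (y , i) ≢ (z , j)
  avoid j≢i e = j≢i (sym (cong proj₂ e))

unshift-forbidden : ∀ c x p q s →
  map (unshiftᴼ B c) (map (unshiftᴼ A c) (forbidden x p q s)) ≡ forbidden x (unshift c p) (unshift c q) (unshift c s)
unshift-forbidden c A p q s = refl
unshift-forbidden c B p q s = refl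

obstructed-dropVertex : ∀ j w x p q s → forbidden x p q s ⊆ occurrences 0 0 w →
  suc j ≢ p → suc j ≢ q → suc j ≢ s → Obstructed (occurrences 0 0 (dropVertex (suc j) w))
obstructed-dropVertex j w x p q s sub j≢p j≢q j≢s =
  x , _ , _ , _ ,
  subst (_⊆ occurrences 0 0 (dropVertex (suc j) w)) (unshift-forbidden (suc j) x p q s)
    (delOccB-⊆ j 0 0 (suc j) _ c≡ (delOccA-⊆ j 0 0 (suc j) w c≡ sub (forbidden-avoids (suc j) x p q s A j≢p j≢q j≢s))
      (unshiftA-avoidsB (suc j) _ (forbidden-avoids (suc j) x p q s B j≢p j≢q j≢s)))
  where
  c≡ : suc j ≡ suc (j + 0)
  c≡ = cong suc (sym (+-identityʳ j))

infixr 5 _∷⁺_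

_∷⁺_ : ℕ → List ℕ → List ℕ
zero ∷⁺ l = l
suc t ∷⁺ l = suc t ∷ l

∷⁺-injectiveʳ : ∀ t {l l'} → t ∷⁺ l ≡ t ∷⁺ l' → l ≡ l'
∷⁺-injectiveʳ zero e = e
∷⁺-injectiveʳ (suc t) e = ∷-injectiveʳ e

minusComposition : ℕ → List ℕ → List ℕ
minusComposition j [] = []
minusComposition j (t ∷ l) with j ≤? t
... | yes _ = pred t ∷⁺ l
... | no _ = t ∷ minusComposition (j ∸ t) l

HasComposition-block : ∀ z t rest ls → 1 ≤ t → HasComposition rest ls → HasComposition (block z t ++ rest) (t ∷ ls)
HasComposition-block z (suc t) rest ls _ h = s≤s z≤n , z , rest , refl , h

HasComposition-block⁺ : ∀ z t rest ls → HasComposition rest ls → HasComposition (block z t ++ rest) (t ∷⁺ ls)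
HasComposition-block⁺ z zero rest ls h = h
HasComposition-block⁺ z (suc t) rest ls h = HasComposition-block z (suc t) rest ls (s≤s z≤n) h

delOccA-run : ∀ t j w → 1 ≤ j → j ≤ t → delOcc A j (replicate t A ++ w) ≡ replicate (pred t) A ++ w
delOccA-run (suc t) 1 w _ _ = refl
delOccA-run (suc (suc t)) (suc (suc j)) w _ (s≤s j≤t) = cong (A ∷_) (delOccA-run (suc t) (suc j) w (s≤s z≤n) j≤t)

delOccB-run : ∀ t j w → 1 ≤ j → j ≤ t → delOcc B j (replicate t B ++ w) ≡ replicate (pred t) B ++ w
delOccB-run (suc t) 1 w _ _ = refl
delOccB-run (suc (suc t)) (suc (suc j)) w _ (s≤s j≤t) = cong (B ∷_) (delOccB-run (suc t) (suc j) w (s≤s z≤n) j≤t)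

delOccA-runB : ∀ t j w → delOcc A j (replicate t B ++ w) ≡ replicate t B ++ delOcc A j w
delOccA-runB zero j w = refl
delOccA-runB (suc t) j w = cong (B ∷_) (delOccA-runB t j w)

delOccB-runA : ∀ t j w → delOcc B j (replicate t A ++ w) ≡ replicate t A ++ delOcc B j w
delOccB-runA zero j w = refl
delOccB-runA (suc t) j w = cong (A ∷_) (delOccB-runA t j w)

delOccA-pastRun : ∀ t j w → delOcc A (suc (t + j)) (replicate t A ++ w) ≡ replicate t A ++ delOcc A (suc j) w
delOccA-pastRun zero j w = refl
delOccA-pastRun (suc t) j w = cong (A ∷_) (delOccA-pastRun t j w)

delOccB-pastRun : ∀ t j w → delOcc B (suc (t + j)) (replicate t B ++ w) ≡ replicate t B ++ delOcc B (suc j) w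
delOccB-pastRun zero j w = refl
delOccB-pastRun (suc t) j w = cong (B ∷_) (delOccB-pastRun t j w)

dropVertex-inBlock : ∀ z t j rest → 1 ≤ j → j ≤ t → dropVertex j (block z t ++ rest) ≡ block z (pred t) ++ rest
dropVertex-inBlock A t j rest 1≤j j≤t = begin
  dropVertex j (block A t ++ rest)                             ≡⟨ cong (dropVertex j) (++-assoc (replicate t A) _ rest) ⟩
  delOcc B j (delOcc A j (replicate t A ++ replicate t B ++ rest)) ≡⟨ cong (delOcc B j) (delOccA-run t j _ 1≤j j≤t) ⟩
  delOcc B j (replicate (pred t) A ++ replicate t B ++ rest)   ≡⟨ delOccB-runA (pred t) j _ ⟩
  replicate (pred t) A ++ delOcc B j (replicate t B ++ rest)   ≡⟨ cong (replicate (pred t) A ++_) (delOccB-run t j rest 1≤j j≤t) ⟩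
  replicate (pred t) A ++ replicate (pred t) B ++ rest         ≡⟨ sym (++-assoc (replicate (pred t) A) _ rest) ⟩
  block A (pred t) ++ rest                                     ∎
dropVertex-inBlock B t j rest 1≤j j≤t = begin
  dropVertex j (block B t ++ rest)                             ≡⟨ cong (dropVertex j) (++-assoc (replicate t B) _ rest) ⟩
  delOcc B j (delOcc A j (replicate t B ++ replicate t A ++ rest)) ≡⟨ cong (delOcc B j) (delOccA-runB t j _) ⟩
  delOcc B j (replicate t B ++ delOcc A j (replicate t A ++ rest)) ≡⟨ cong (λ v → delOcc B j (replicate t B ++ v)) (delOccA-run t j rest 1≤j j≤t) ⟩
  delOcc B j (replicate t B ++ replicate (pred t) A ++ rest)   ≡⟨ delOccB-run t j _ 1≤j j≤t ⟩
  replicate (pred t) B ++ replicate (pred t) A ++ rest         ≡⟨ sym (++-assoc (replicate (pred t) B) _ rest) ⟩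
  block B (pred t) ++ rest                                     ∎

dropVertex-pastBlock : ∀ z t j rest → dropVertex (suc (t + j)) (block z t ++ rest) ≡ block z t ++ dropVertex (suc j) rest
dropVertex-pastBlock A t j rest = begin
  dropVertex J (block A t ++ rest)                                     ≡⟨ cong (dropVertex J) (++-assoc (replicate t A) _ rest) ⟩
  delOcc B J (delOcc A J (replicate t A ++ replicate t B ++ rest))     ≡⟨ cong (delOcc B J) (delOccA-pastRun t j _) ⟩
  delOcc B J (replicate t A ++ delOcc A (suc j) (replicate t B ++ rest)) ≡⟨ cong (λ v → delOcc B J (replicate t A ++ v)) (delOccA-runB t (suc j) rest) ⟩
  delOcc B J (replicate t A ++ replicate t B ++ delOcc A (suc j) rest) ≡⟨ delOccB-runA t J _ ⟩
  replicate t A ++ delOcc B J (replicate t B ++ delOcc A (suc j) rest) ≡⟨ cong (replicate t A ++_) (delOccB-pastRun t j _) ⟩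
  replicate t A ++ replicate t B ++ dropVertex (suc j) rest           ≡⟨ sym (++-assoc (replicate t A) _ _) ⟩
  block A t ++ dropVertex (suc j) rest                                ∎
  where J = suc (t + j)
dropVertex-pastBlock B t j rest = begin
  dropVertex J (block B t ++ rest)                                     ≡⟨ cong (dropVertex J) (++-assoc (replicate t B) _ rest) ⟩
  delOcc B J (delOcc A J (replicate t B ++ replicate t A ++ rest))     ≡⟨ cong (delOcc B J) (delOccA-runB t J _) ⟩
  delOcc B J (replicate t B ++ delOcc A J (replicate t A ++ rest))     ≡⟨ cong (λ v → delOcc B J (replicate t B ++ v)) (delOccA-pastRun t j rest) ⟩
  delOcc B J (replicate t B ++ replicate t A ++ delOcc A (suc j) rest) ≡⟨ delOccB-pastRun t j _ ⟩
  replicate t B ++ delOcc B (suc j) (replicate t A ++ delOcc A (suc j) rest) ≡⟨ cong (replicate t B ++_) (delOccB-runA t (suc j) _) ⟩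
  replicate t B ++ replicate t A ++ dropVertex (suc j) rest           ≡⟨ sym (++-assoc (replicate t B) _ _) ⟩
  block B t ++ dropVertex (suc j) rest                                ∎
  where J = suc (t + j)

dropVertex-composition : ∀ w ls j → HasComposition w ls → 1 ≤ j → j ≤ sum ls →
  HasComposition (dropVertex j w) (minusComposition j ls)
dropVertex-composition [] [] (suc j) _ _ ()
dropVertex-composition (c ∷ w) (t ∷ ls) j (1≤t , z , rest , eq , h) 1≤j j≤ rewrite eq with j ≤? t
... | yes j≤t = subst (λ v → HasComposition v (pred t ∷⁺ ls)) (sym (dropVertex-inBlock z t j rest 1≤j j≤t))
                  (HasComposition-block⁺ z (pred t) rest ls h)
... | no j≰t with m≤n⇒∃[o]m+o≡n (≰⇒> j≰t)
... | j' , refl =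
  subst (λ v → HasComposition v _) (sym (dropVertex-pastBlock z t j' rest)) (HasComposition-block z t _ _ 1≤t (
  subst (λ i → HasComposition (dropVertex (suc j') rest) (minusComposition i ls)) (sym suc[t+j']∸t)
    (dropVertex-composition rest ls (suc j') h (s≤s z≤n) (+-cancelˡ-≤ t _ _ (subst (_≤ t + sum ls) (sym (+-suc t j')) j≤)))))
  where
  suc[t+j']∸t : suc (t + j') ∸ t ≡ suc j'
  suc[t+j']∸t = trans (cong (_∸ t) (sym (+-suc t j'))) (m+n∸m≡n t (suc j'))

-- Separating distinct compositions

separate-head-one : ∀ l s m → 3 ≤ suc (suc s) + sum m →
  ∃[ j ] 1 ≤ j × j ≤ 3 × minusComposition j (1 ∷ l) ≢ minusComposition j (suc (suc s) ∷ m)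
separate-head-one l s m 3≤ with ≡-dec _≟_ l (suc s ∷ m)
... | no l≢ = 1 , s≤s z≤n , s≤s z≤n , l≢
separate-head-one .(suc (suc s) ∷ m) (suc s) m 3≤ | yes refl = 2 , s≤s z≤n , s≤s (s≤s z≤n) , λ ()
separate-head-one .(1 ∷ u ∷ m) zero (u ∷ m) 3≤ | yes refl = 3 , s≤s z≤n , ≤-refl , λ ()
separate-head-one .(1 ∷ []) zero [] (s≤s (s≤s ())) | yes refl

separating-index : ∀ l m → All (1 ≤_) l → All (1 ≤_) m → sum l ≡ sum m → 3 ≤ sum l → l ≢ m →
  ∃[ j ] 1 ≤ j × j ≤ 3 × minusComposition j l ≢ minusComposition j m
separating-index (suc t ∷ l) (suc s ∷ m) _ _ sum≡ 3≤ l≢m with t ≟ s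
... | yes refl = 1 , s≤s z≤n , s≤s z≤n , λ e → l≢m (cong (suc t ∷_) (∷⁺-injectiveʳ t e))
separating-index (1 ∷ l) (1 ∷ m) _ _ sum≡ 3≤ l≢m | no t≢s = ⊥-elim (t≢s refl)
separating-index (suc (suc t) ∷ l) (suc (suc s) ∷ m) _ _ sum≡ 3≤ l≢m | no t≢s =
  1 , s≤s z≤n , s≤s z≤n , λ e → t≢s (∷-injectiveˡ e)
separating-index (1 ∷ l) (suc (suc s) ∷ m) _ _ sum≡ 3≤ l≢m | no _ = separate-head-one l s m (subst (3 ≤_) sum≡ 3≤)
separating-index (suc (suc t) ∷ l) (1 ∷ m) _ _ sum≡ 3≤ l≢m | no _ with separate-head-one m t l 3≤
... | j , 1≤j , j≤3 , differ = j , 1≤j , j≤3 , λ e → differ (sym e)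
separating-index [] m _ _ _ () _
separating-index (zero ∷ l) m (() ∷ _) _ _ _ _
separating-index (suc t ∷ l) (zero ∷ m) _ (() ∷ _) _ _ _
separating-index (_ ∷ _) [] _ _ sum≡ 3≤ _ with subst (3 ≤_) sum≡ 3≤
... | ()

HasComposition-normalise : ∀ w ls → HasComposition w ls → HasComposition (normalise w) ls
HasComposition-normalise [] ls h = h
HasComposition-normalise (A ∷ w) ls h = h
HasComposition-normalise (B ∷ w) ls h = HasComposition-map-swap (B ∷ w) ls h

¬Collectable-normalise : ∀ w → ¬ Collectable w → ¬ Collectable (normalise w)
¬Collectable-normalise [] ¬c = ¬c
¬Collectable-normalise (A ∷ w) ¬c = ¬c
¬Collectable-normalise (B ∷ w) ¬c (ls , h) =
  ¬c (ls , subst (λ v → HasComposition v ls) (map-swap-involutive (B ∷ w)) (HasComposition-map-swap _ ls h))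

MismatchW-sym : ∀ p q → MismatchW p q → MismatchW q p
MismatchW-sym p q (inj₁ (cp , ¬cq)) = inj₂ (inj₁ (¬cq , cp))
MismatchW-sym p q (inj₂ (inj₁ (¬cp , cq))) = inj₁ (cq , ¬cp)
MismatchW-sym p q (inj₂ (inj₂ (cp , cq , differ))) =
  inj₂ (inj₂ (cq , cp , λ lq lp hq hp e → differ lp lq hp hq (sym e)))

mismatch-compositions : ∀ p q l m → HasComposition p l → HasComposition q m → l ≢ m → MismatchW p q
mismatch-compositions p q l m hp hq l≢m = inj₂ (inj₂ ((l , hp) , (m , hq) ,
  λ l' m' hp' hq' e → l≢m (trans (composition-unique p l l' hp hp') (trans e (composition-unique q m' m hq' hq)))))

pattern-composition-sum : ∀ {r} (P : Pattern r) ls → HasComposition (word P) ls → sum ls ≡ r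
pattern-composition-sum P ls h = trans (composition-sum _ ls h) (countA P)

minus-collectable : ∀ {r} (P : Pattern r) ls j → HasComposition (word P) ls → 1 ≤ j → j ≤ r →
  HasComposition (minusWord j (word P)) (minusComposition j ls)
minus-collectable P ls j h 1≤j j≤r = HasComposition-normalise _ _
  (dropVertex-composition (word P) ls j h 1≤j (subst (j ≤_) (sym (pattern-composition-sum P ls h)) j≤r))

DeletionMismatch : ∀ {r} → Pattern r → Pattern r → Set
DeletionMismatch {r} P Q = ∃[ j ] 1 ≤ j × j ≤ r × MismatchMinus j P Q

distinct-compositions : ∀ {r} → 3 ≤ r → (P Q : Pattern r) → Collectable (word P) → Collectable (word Q) →
  ((l m : List ℕ) → HasComposition (word P) l → HasComposition (word Q) m → l ≢ m) → DeletionMismatch P Q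
distinct-compositions {r} 3≤r P Q (l , hP) (m , hQ) distinct
  with separating-index l m (composition-positive _ l hP) (composition-positive _ m hQ) (trans sumP (sym sumQ))
         (subst (3 ≤_) (sym sumP) 3≤r) (distinct l m hP hQ)
  where
  sumP : sum l ≡ r
  sumP = pattern-composition-sum P l hP
  sumQ : sum m ≡ r
  sumQ = pattern-composition-sum Q m hQ
... | j , 1≤j , j≤3 , differ =
  j , 1≤j , j≤r , mismatch-compositions _ _ _ _ (minus-collectable P l j hP 1≤j j≤r) (minus-collectable Q m j hQ 1≤j j≤r) differ
  where
  j≤r : j ≤ r
  j≤r = ≤-trans j≤3 3≤r

-- Collectable against non-collectable

avoid₁ : ∀ k s → ∃[ j ] k ≤ j × j ≤ 1 + k × j ≢ s
avoid₁ k s with k ≟ s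
... | no k≢s = k , ≤-refl , n≤1+n k , k≢s
... | yes refl = suc k , n≤1+n k , ≤-refl , 1+n≢n

avoid₂ : ∀ k q s → ∃[ j ] k ≤ j × j ≤ 2 + k × j ≢ q × j ≢ s
avoid₂ k q s with k ≟ q | k ≟ s
... | no k≢q | no k≢s = k , ≤-refl , ≤-trans (n≤1+n k) (n≤1+n _) , k≢q , k≢s
... | yes refl | _ with avoid₁ (suc k) s
...   | j , k<j , j≤ , j≢s = j , ≤-trans (n≤1+n k) k<j , j≤ , >⇒≢ k<j , j≢s
avoid₂ k q s | no _ | yes refl with avoid₁ (suc k) q
...   | j , k<j , j≤ , j≢q = j , ≤-trans (n≤1+n k) k<j , j≤ , j≢q , >⇒≢ k<j

avoid₃ : ∀ k p q s → ∃[ j ] k ≤ j × j ≤ 3 + k × j ≢ p × j ≢ q × j ≢ s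
avoid₃ k p q s with k ≟ p | k ≟ q | k ≟ s
... | no k≢p | no k≢q | no k≢s = k , ≤-refl , ≤-trans (n≤1+n k) (≤-trans (n≤1+n _) (n≤1+n _)) , k≢p , k≢q , k≢s
... | yes refl | _ | _ with avoid₂ (suc k) q s
...   | j , k<j , j≤ , j≢q , j≢s = j , ≤-trans (n≤1+n k) k<j , j≤ , >⇒≢ k<j , j≢q , j≢s
avoid₃ k p q s | no _ | yes refl | _ with avoid₂ (suc k) p s
...   | j , k<j , j≤ , j≢p , j≢s = j , ≤-trans (n≤1+n k) k<j , j≤ , j≢p , >⇒≢ k<j , j≢s
avoid₃ k p q s | no _ | no _ | yes refl with avoid₂ (suc k) p q
...   | j , k<j , j≤ , j≢p , j≢q = j , ≤-trans (n≤1+n k) k<j , j≤ , j≢p , j≢q , >⇒≢ k<j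

collectable-vs-noncollectable₄ : ∀ {r} → 4 ≤ r → (P Q : Pattern r) → Collectable (word P) → ¬ Collectable (word Q) →
  DeletionMismatch P Q
collectable-vs-noncollectable₄ {r} 4≤r P Q (l , hP) ¬cQ
  with collectable⊎obstructed (length (word Q)) 0 (word Q) ≤-refl (trans (countA Q) (sym (countB Q)))
... | inj₁ cQ = ⊥-elim (¬cQ cQ)
... | inj₂ (x , p , q , s , sub) with avoid₃ 1 p q s
...   | suc j , _ , j≤4 , j≢p , j≢q , j≢s =
  suc j , s≤s z≤n , j≤r ,
  inj₁ ((_ , minus-collectable P l (suc j) hP (s≤s z≤n) j≤r) ,
        ¬Collectable-normalise _ (obstructed⇒¬collectable _ (obstructed-dropVertex j (word Q) x p q s sub j≢p j≢q j≢s)))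
  where
  j≤r : suc j ≤ r
  j≤r = ≤-trans j≤4 4≤r

AABABB : List Letter
AABABB = A ∷ A ∷ B ∷ A ∷ B ∷ B ∷ []

noncollectable-3-pattern : ∀ w → length w ≡ 6 → count A w ≡ 3 → StartsWithA w → ¬ Collectable w → w ≡ AABABB
noncollectable-3-pattern (B ∷ _ ∷ _ ∷ _ ∷ _ ∷ _ ∷ []) _ _ () _
noncollectable-3-pattern (A ∷ A ∷ A ∷ A ∷ _ ∷ _ ∷ []) _ () _ _
noncollectable-3-pattern (A ∷ A ∷ A ∷ B ∷ A ∷ _ ∷ []) _ () _ _
noncollectable-3-pattern (A ∷ A ∷ A ∷ B ∷ B ∷ A ∷ []) _ () _ _
noncollectable-3-pattern (A ∷ A ∷ A ∷ B ∷ B ∷ B ∷ []) _ _ _ ¬c = ⊥-elim (¬c (3 ∷ [] , s≤s z≤n , A , _ , refl , tt))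
noncollectable-3-pattern (A ∷ A ∷ B ∷ A ∷ A ∷ _ ∷ []) _ () _ _
noncollectable-3-pattern (A ∷ A ∷ B ∷ A ∷ B ∷ A ∷ []) _ () _ _
noncollectable-3-pattern (A ∷ A ∷ B ∷ A ∷ B ∷ B ∷ []) _ _ _ _ = refl
noncollectable-3-pattern (A ∷ A ∷ B ∷ B ∷ A ∷ A ∷ []) _ () _ _
noncollectable-3-pattern (A ∷ A ∷ B ∷ B ∷ A ∷ B ∷ []) _ _ _ ¬c =
  ⊥-elim (¬c (2 ∷ 1 ∷ [] , s≤s z≤n , A , _ , refl , s≤s z≤n , A , _ , refl , tt))
noncollectable-3-pattern (A ∷ A ∷ B ∷ B ∷ B ∷ A ∷ []) _ _ _ ¬c =
  ⊥-elim (¬c (2 ∷ 1 ∷ [] , s≤s z≤n , A , _ , refl , s≤s z≤n , B , _ , refl , tt))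
noncollectable-3-pattern (A ∷ A ∷ B ∷ B ∷ B ∷ B ∷ []) _ () _ _
noncollectable-3-pattern (A ∷ B ∷ A ∷ A ∷ A ∷ _ ∷ []) _ () _ _
noncollectable-3-pattern (A ∷ B ∷ A ∷ A ∷ B ∷ A ∷ []) _ () _ _
noncollectable-3-pattern (A ∷ B ∷ A ∷ A ∷ B ∷ B ∷ []) _ _ _ ¬c =
  ⊥-elim (¬c (1 ∷ 2 ∷ [] , s≤s z≤n , A , _ , refl , s≤s z≤n , A , _ , refl , tt))
noncollectable-3-pattern (A ∷ B ∷ A ∷ B ∷ A ∷ A ∷ []) _ () _ _
noncollectable-3-pattern (A ∷ B ∷ A ∷ B ∷ A ∷ B ∷ []) _ _ _ ¬c =
  ⊥-elim (¬c (1 ∷ 1 ∷ 1 ∷ [] , s≤s z≤n , A , _ , refl , s≤s z≤n , A , _ , refl , s≤s z≤n , A , _ , refl , tt))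
noncollectable-3-pattern (A ∷ B ∷ A ∷ B ∷ B ∷ A ∷ []) _ _ _ ¬c =
  ⊥-elim (¬c (1 ∷ 1 ∷ 1 ∷ [] , s≤s z≤n , A , _ , refl , s≤s z≤n , A , _ , refl , s≤s z≤n , B , _ , refl , tt))
noncollectable-3-pattern (A ∷ B ∷ A ∷ B ∷ B ∷ B ∷ []) _ () _ _
noncollectable-3-pattern (A ∷ B ∷ B ∷ A ∷ A ∷ A ∷ []) _ () _ _
noncollectable-3-pattern (A ∷ B ∷ B ∷ A ∷ A ∷ B ∷ []) _ _ _ ¬c =
  ⊥-elim (¬c (1 ∷ 1 ∷ 1 ∷ [] , s≤s z≤n , A , _ , refl , s≤s z≤n , B , _ , refl , s≤s z≤n , A , _ , refl , tt))
noncollectable-3-pattern (A ∷ B ∷ B ∷ A ∷ B ∷ A ∷ []) _ _ _ ¬c =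
  ⊥-elim (¬c (1 ∷ 1 ∷ 1 ∷ [] , s≤s z≤n , A , _ , refl , s≤s z≤n , B , _ , refl , s≤s z≤n , B , _ , refl , tt))
noncollectable-3-pattern (A ∷ B ∷ B ∷ A ∷ B ∷ B ∷ []) _ () _ _
noncollectable-3-pattern (A ∷ B ∷ B ∷ B ∷ A ∷ A ∷ []) _ _ _ ¬c =
  ⊥-elim (¬c (1 ∷ 2 ∷ [] , s≤s z≤n , A , _ , refl , s≤s z≤n , B , _ , refl , tt))
noncollectable-3-pattern (A ∷ B ∷ B ∷ B ∷ A ∷ B ∷ []) _ () _ _
noncollectable-3-pattern (A ∷ B ∷ B ∷ B ∷ B ∷ A ∷ []) _ () _ _
noncollectable-3-pattern (A ∷ B ∷ B ∷ B ∷ B ∷ B ∷ []) _ () _ _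

compositions-of-3 : ∀ l → All (1 ≤_) l → sum l ≡ 3 →
  l ≡ 3 ∷ [] ⊎ l ≡ 1 ∷ 2 ∷ [] ⊎ l ≡ 2 ∷ 1 ∷ [] ⊎ l ≡ 1 ∷ 1 ∷ 1 ∷ []
compositions-of-3 [] _ ()
compositions-of-3 (zero ∷ _) (() ∷ _) _
compositions-of-3 (1 ∷ []) _ ()
compositions-of-3 (1 ∷ zero ∷ _) (_ ∷ () ∷ _) _
compositions-of-3 (1 ∷ 1 ∷ []) _ ()
compositions-of-3 (1 ∷ 1 ∷ zero ∷ _) (_ ∷ _ ∷ () ∷ _) _
compositions-of-3 (1 ∷ 1 ∷ 1 ∷ []) _ _ = inj₂ (inj₂ (inj₂ refl))
compositions-of-3 (1 ∷ 1 ∷ 1 ∷ zero ∷ _) (_ ∷ _ ∷ _ ∷ () ∷ _) _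
compositions-of-3 (1 ∷ 1 ∷ 1 ∷ suc _ ∷ _) _ ()
compositions-of-3 (1 ∷ 1 ∷ suc (suc _) ∷ _) _ ()
compositions-of-3 (1 ∷ 2 ∷ []) _ _ = inj₂ (inj₁ refl)
compositions-of-3 (1 ∷ 2 ∷ zero ∷ _) (_ ∷ _ ∷ () ∷ _) _
compositions-of-3 (1 ∷ 2 ∷ suc _ ∷ _) _ ()
compositions-of-3 (1 ∷ suc (suc (suc _)) ∷ _) _ ()
compositions-of-3 (2 ∷ []) _ ()
compositions-of-3 (2 ∷ zero ∷ _) (_ ∷ () ∷ _) _
compositions-of-3 (2 ∷ 1 ∷ []) _ _ = inj₂ (inj₂ (inj₁ refl))
compositions-of-3 (2 ∷ 1 ∷ zero ∷ _) (_ ∷ _ ∷ () ∷ _) _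
compositions-of-3 (2 ∷ 1 ∷ suc _ ∷ _) _ ()
compositions-of-3 (2 ∷ suc (suc _) ∷ _) _ ()
compositions-of-3 (3 ∷ []) _ _ = inj₁ refl
compositions-of-3 (3 ∷ zero ∷ _) (_ ∷ () ∷ _) _
compositions-of-3 (3 ∷ suc _ ∷ _) _ ()
compositions-of-3 (suc (suc (suc (suc _))) ∷ _) _ ()

AABABB-minus-1 : HasComposition (minusWord 1 AABABB) (2 ∷ [])
AABABB-minus-1 = s≤s z≤n , A , _ , refl , tt

AABABB-minus-2 : HasComposition (minusWord 2 AABABB) (1 ∷ 1 ∷ [])
AABABB-minus-2 = s≤s z≤n , A , _ , refl , s≤s z≤n , A , _ , refl , tt

AABABB-minus-3 : HasComposition (minusWord 3 AABABB) (2 ∷ [])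
AABABB-minus-3 = s≤s z≤n , A , _ , refl , tt

mismatch-with-AABABB : (P Q : Pattern 3) → word Q ≡ AABABB → ∀ l j m → HasComposition (word P) l → 1 ≤ j → j ≤ 3 →
  HasComposition (minusWord j AABABB) m → minusComposition j l ≢ m → DeletionMismatch P Q
mismatch-with-AABABB P Q Q≡ l j m hP 1≤j j≤3 hQ differ =
  j , 1≤j , j≤3 ,
  subst (λ v → MismatchW (minusWord j (word P)) (minusWord j v)) (sym Q≡)
    (mismatch-compositions _ _ _ _ (minus-collectable P l j hP 1≤j j≤3) hQ differ)

collectable-vs-noncollectable₃ : (P Q : Pattern 3) → Collectable (word P) → ¬ Collectable (word Q) → DeletionMismatch P Q
collectable-vs-noncollectable₃ P Q (l , hP) ¬cQ
  with noncollectable-3-pattern (word Q) (len Q) (countA Q) (startA Q) ¬cQ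
     | compositions-of-3 l (composition-positive _ l hP) (pattern-composition-sum P l hP)
... | Q≡ | inj₁ refl =
  mismatch-with-AABABB P Q Q≡ _ 2 _ hP (s≤s z≤n) (s≤s (s≤s z≤n)) AABABB-minus-2 (λ ())
... | Q≡ | inj₂ (inj₁ refl) =
  mismatch-with-AABABB P Q Q≡ _ 3 _ hP (s≤s z≤n) ≤-refl AABABB-minus-3 (λ ())
... | Q≡ | inj₂ (inj₂ (inj₁ refl)) =
  mismatch-with-AABABB P Q Q≡ _ 1 _ hP (s≤s z≤n) (s≤s z≤n) AABABB-minus-1 (λ ())
... | Q≡ | inj₂ (inj₂ (inj₂ refl)) =
  mismatch-with-AABABB P Q Q≡ _ 1 _ hP (s≤s z≤n) (s≤s z≤n) AABABB-minus-1 (λ ())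

collectable-vs-noncollectable : ∀ {r} → 3 ≤ r → (P Q : Pattern r) → Collectable (word P) → ¬ Collectable (word Q) →
  DeletionMismatch P Q
collectable-vs-noncollectable {3} _ = collectable-vs-noncollectable₃
collectable-vs-noncollectable {suc (suc (suc (suc r)))} _ = collectable-vs-noncollectable₄ (s≤s (s≤s (s≤s (s≤s z≤n))))
collectable-vs-noncollectable {1} (s≤s ())
collectable-vs-noncollectable {2} (s≤s (s≤s ()))

mainTheorem12 : (r : ℕ) → 3 ≤ r → (P Q : Pattern r) → Mismatch P Q →
    Σ ℕ (λ j → (1 ≤ j) × (j ≤ r) × MismatchMinus j P Q)
mainTheorem12 r 3≤r P Q (inj₁ (cP , ¬cQ)) = collectable-vs-noncollectable 3≤r P Q cP ¬cQ
mainTheorem12 r 3≤r P Q (inj₂ (inj₁ (¬cP , cQ))) with collectable-vs-noncollectable 3≤r Q P cQ ¬cP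
... | j , 1≤j , j≤r , mismatch = j , 1≤j , j≤r , MismatchW-sym _ _ mismatch
mainTheorem12 r 3≤r P Q (inj₂ (inj₂ (cP , cQ , distinct))) = distinct-compositions 3≤r P Q cP cQ distinct
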